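{- Let $(X,d)$ be a premetric space. Then the relation $d$ defined on the collection of all Cauchy families on $X$ (by: $d(F,F')\leq q$ iff for every rational $\varepsilon>0$ there exist $S\in F$ and $T\in F'$ with $\operatorname{diam} S\leq\varepsilon$, $\operatorname{diam} T\leq\varepsilon$ and $\operatorname{diam}(S\cup T)\leq q+\varepsilon$) is a pseudo-premetric on the collection of Cauchy families on $X$.
   Context: A premetric on a nonempty set $X$ is a relation $d$ between $X\times X$ and the nonnegative rationals, written $d(x,y)\leq q$ for $((x,y),q)\in d$, such that for all $x,y,z\in X$ and nonnegative rationals $p,q$: (1) $d(x,y)\leq 0$ iff $x=y$; (2) if $d(x,y)\leq q$ then $d(y,x)\leq q$; (3) if $d(x,z)\leq p$ and $d(z,y)\leq q$ then $d(x,y)\leq p+q$; (4) $d(x,y)\leq p$ iff $d(x,y)\leq q$ for all rationals $q>p$. A pseudo-premetric is such a relation satisfying (2), (3), (4) and $d(x,x)\leq 0$ for all $x$ (instead of (1)). For $A\subseteq X$ and a nonnegative rational $q$, write $\operatorname{diam} A\leq q$ if $d(x,y)\leq q$ for all $x,y\in A$. A Cauchy family on $X$ is a set $F\subseteq\mathcal{P}(X)$ such that (i) $S\cap T\neq\emptyset$ for all $S,T\in F$, and (ii) for every rational $\varepsilon>0$ there is $S\in F$ with $\operatorname{diam} S\leq\varepsilon$. -}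

module Defs where

open import Level using (Level; _⊔_; suc)
open import Data.Rational using (ℚ; 0ℚ; _+_; _≤_; _<_)
open import Data.Product using (Σ; _×_; ∃; _,_)
open import Data.Sum using (_⊎_)
open import Relation.Binary.PropositionalEquality using (_≡_)
open import Function.Bundles using (_⇔_)

-- A relation between X × X and the rationals; "d x y q" reads d(x,y) ≤ q.
-- Only nonnegative q are relevant: all axioms quantify over q with 0 ≤ q.
Rel : ∀ {a} (X : Set a) (ℓ : Level) → Set (a ⊔ suc ℓ)
Rel X ℓ = X → X → ℚ → Set ℓ

module _ {a ℓ} {X : Set a} (d : Rel X ℓ) where

  Symmetric : Set (a ⊔ ℓ)
  Symmetric = ∀ x y (q : ℚ) → 0ℚ ≤ q → d x y q → d y x q

  Triangle : Set (a ⊔ ℓ)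
  Triangle = ∀ x y z (p q : ℚ) → 0ℚ ≤ p → 0ℚ ≤ q →
             d x z p → d z y q → d x y (p + q)

  Continuity : Set (a ⊔ ℓ)
  Continuity = ∀ x y (p : ℚ) → 0ℚ ≤ p →
               d x y p ⇔ (∀ (q : ℚ) → p < q → d x y q)

  record IsPremetric : Set (a ⊔ ℓ) where
    field
      zero-iff : ∀ x y → d x y 0ℚ ⇔ (x ≡ y)
      sym      : Symmetric
      triangle : Triangle
      cont     : Continuity

  record IsPseudoPremetric : Set (a ⊔ ℓ) where
    field
      refl0    : ∀ x → d x x 0ℚ
      sym      : Symmetric
      triangle : Triangle
      cont     : Continuity

Subset : ∀ {a} (X : Set a) → Set (suc a)
Subset {a} X = X → Set a

module _ {a ℓ} {X : Set a} (d : Rel X ℓ) where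

  Diam≤ : Subset X → ℚ → Set (a ⊔ ℓ)
  Diam≤ A q = ∀ x y → A x → A y → d x y q

  _∪_ : Subset X → Subset X → Subset X
  (S ∪ T) x = S x ⊎ T x

  Family : Set (suc a)
  Family = Subset X → Set a

  record IsCauchy (F : Family) : Set (suc a ⊔ ℓ) where
    field
      meets : ∀ S T → F S → F T → ∃ λ x → S x × T x
      small : ∀ (ε : ℚ) → 0ℚ < ε → ∃ λ S → F S × Diam≤ S ε

  CauchyFamily : Set (suc a ⊔ ℓ)
  CauchyFamily = Σ Family IsCauchy

  dCF : Rel CauchyFamily (suc a ⊔ ℓ)
  dCF (F , _) (F' , _) q =
    ∀ (ε : ℚ) → 0ℚ < ε →
      ∃ λ S → ∃ λ T → F S × F' T × Diam≤ S ε × Diam≤ T ε × Diam≤ (S ∪ T) (q + ε)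

-- Reflexivity takes S = T small in F, and symmetry swaps the witnesses.
-- For the triangle inequality, witnesses S, U for d(F,H) ≤ p and U', T for
-- d(H,G) ≤ q taken with tolerance ε/2 have U ∩ U' ≠ ∅ because H is Cauchy,
-- and a common point z bridges S and T, so diam(S ∪ T) ≤ p + q + ε.
-- Continuity of the induced relation follows by testing q = p + ε/2 with
-- tolerance ε/2, using that d(x,y) ≤ p is monotone in p.
module Submission where

open import Defs
open import Data.Rational using (ℚ; 0ℚ; _+_; _*_; _≤_; _<_; ½)
open import Data.Rational.Properties
open import Algebra.Bundles using (CommutativeMonoid)
open import Algebra.Properties.CommutativeSemigroup (CommutativeMonoid.commutativeSemigroup +-0-commutativeMonoid) using (interchange)
open import Data.Product using (_,_)
open import Data.Sum using (inj₁; inj₂)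
open import Relation.Nullary using (yes; no)
open import Relation.Binary.PropositionalEquality
open import Function.Bundles using (mk⇔; Equivalence)

half : ℚ → ℚ
half ε = ½ * ε

half-pos : ∀ {ε} → 0ℚ < ε → 0ℚ < half ε
half-pos {ε} 0<ε = subst (_< ½ * ε) (*-zeroʳ ½) (*-monoʳ-<-pos ½ 0<ε)

half+half : ∀ ε → half ε + half ε ≡ ε
half+half ε = trans (sym (*-distribʳ-+ ε ½ ½)) (*-identityˡ ε)

+-nonNeg : ∀ {p q} → 0ℚ ≤ p → 0ℚ ≤ q → 0ℚ ≤ p + q
+-nonNeg {p} {q} 0≤p 0≤q = subst (_≤ p + q) (+-identityʳ 0ℚ) (+-mono-≤ 0≤p 0≤q)

p≤q+p : ∀ {p q} → 0ℚ ≤ q → p ≤ q + p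
p≤q+p {p} {q} 0≤q = subst (_≤ q + p) (+-identityˡ p) (+-monoˡ-≤ p 0≤q)

p<p+q : ∀ {p q} → 0ℚ < q → p < p + q
p<p+q {p} {q} 0<q = subst (_< p + q) (+-identityʳ p) (+-monoʳ-< p 0<q)

half≤id : ∀ {ε} → 0ℚ < ε → half ε ≤ ε
half≤id {ε} 0<ε = subst (half ε ≤_) (half+half ε) (p≤q+p (<⇒≤ (half-pos 0<ε)))

module _ {a ℓ} {X : Set a} (d : Rel X ℓ) where

  Diam≤-∪ : ∀ {S T r} → Diam≤ d S r → Diam≤ d T r →
            (∀ x y → S x → T y → d x y r) → (∀ x y → T x → S y → d x y r) →
            Diam≤ d (_∪_ d S T) r
  Diam≤-∪ dS dT dST dTS x y (inj₁ sx) (inj₁ sy) = dS x y sx sy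
  Diam≤-∪ dS dT dST dTS x y (inj₁ sx) (inj₂ ty) = dST x y sx ty
  Diam≤-∪ dS dT dST dTS x y (inj₂ tx) (inj₁ sy) = dTS x y tx sy
  Diam≤-∪ dS dT dST dTS x y (inj₂ tx) (inj₂ ty) = dT x y tx ty

  Diam≤-∪-comm : ∀ {S T r} → Diam≤ d (_∪_ d S T) r → Diam≤ d (_∪_ d T S) r
  Diam≤-∪-comm {S} {T} dST x y tsx tsy = dST x y (swap tsx) (swap tsy)
    where
    swap : ∀ {z} → _∪_ d T S z → _∪_ d S T z
    swap (inj₁ t) = inj₂ t
    swap (inj₂ s) = inj₁ s

  Diam≤-chain : Triangle d → ∀ {A B p q x y z} → 0ℚ ≤ p → 0ℚ ≤ q →
                Diam≤ d A p → Diam≤ d B q → A x → A z → B z → B y → d x y (p + q)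
  Diam≤-chain tri {x = x} {y} {z} 0≤p 0≤q dA dB ax az bz by =
    tri x y z _ _ 0≤p 0≤q (dA x z ax az) (dB z y bz by)

  module _ (cont : Continuity d) where

    cont⇒mono : ∀ {x y p r} → 0ℚ ≤ p → p ≤ r → d x y p → d x y r
    cont⇒mono {x} {y} {p} {r} 0≤p p≤r dp with p <? r
    ... | yes p<r = Equivalence.to (cont x y p 0≤p) dp r p<r
    ... | no p≮r = subst (d x y) (≤-antisym p≤r (≮⇒≥ p≮r)) dp

    Diam≤-mono : ∀ {S p r} → 0ℚ ≤ p → p ≤ r → Diam≤ d S p → Diam≤ d S r
    Diam≤-mono 0≤p p≤r dS x y sx sy = cont⇒mono 0≤p p≤r (dS x y sx sy)

    Diam≤-half⇒Diam≤ : ∀ {S ε} → 0ℚ < ε → Diam≤ d S (half ε) → Diam≤ d S ε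
    Diam≤-half⇒Diam≤ 0<ε = Diam≤-mono (<⇒≤ (half-pos 0<ε)) (half≤id 0<ε)

  dCF-refl0 : ∀ F → dCF d F F 0ℚ
  dCF-refl0 (_ , cauchy) ε 0<ε with IsCauchy.small cauchy ε 0<ε
  ... | S , FS , dS = S , S , FS , FS , dS , dS ,
    subst (Diam≤ d (_∪_ d S S)) (sym (+-identityˡ ε)) (Diam≤-∪ dS dS dS dS)

  dCF-sym : Symmetric (dCF d)
  dCF-sym _ _ _ _ F~G ε 0<ε with F~G ε 0<ε
  ... | S , T , FS , GT , dS , dT , dST = T , S , GT , FS , dT , dS , Diam≤-∪-comm dST

  dCF-triangle : Continuity d → Triangle d → Triangle (dCF d)
  dCF-triangle cont tri _ _ (_ , cauchy) p q 0≤p 0≤q F~H H~G ε 0<ε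
    with F~H (half ε) (half-pos 0<ε) | H~G (half ε) (half-pos 0<ε)
  ... | S , U , FS , HU , dS , _ , dSU | U′ , T , HU′ , GT , _ , dT , dU′T
    with IsCauchy.meets cauchy U U′ HU HU′
  ... | z , zU , zU′ =
    S , T , FS , GT , Diam≤-half⇒Diam≤ cont 0<ε dS , Diam≤-half⇒Diam≤ cont 0<ε dT ,
    Diam≤-∪ (widen dS) (widen dT) S-to-T T-to-S
    where
    0≤h : 0ℚ ≤ half ε
    0≤h = <⇒≤ (half-pos 0<ε)

    widen : ∀ {A} → Diam≤ d A (half ε) → Diam≤ d A ((p + q) + ε)
    widen = Diam≤-mono cont 0≤h (≤-trans (half≤id 0<ε) (p≤q+p (+-nonNeg 0≤p 0≤q)))

    total : (p + half ε) + (q + half ε) ≡ (p + q) + ε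
    total = trans (interchange p (half ε) q (half ε)) (cong ((p + q) +_) (half+half ε))

    S-to-T : ∀ x y → S x → T y → d x y ((p + q) + ε)
    S-to-T x y sx ty = subst (d x y) total
      (Diam≤-chain tri (+-nonNeg 0≤p 0≤h) (+-nonNeg 0≤q 0≤h) dSU dU′T
        (inj₁ sx) (inj₂ zU) (inj₁ zU′) (inj₂ ty))

    T-to-S : ∀ x y → T x → S y → d x y ((p + q) + ε)
    T-to-S x y tx sy = subst (d x y) (trans (+-comm (q + half ε) (p + half ε)) total)
      (Diam≤-chain tri (+-nonNeg 0≤q 0≤h) (+-nonNeg 0≤p 0≤h) dU′T dSU
        (inj₂ tx) (inj₁ zU′) (inj₂ zU) (inj₁ sy))

  dCF-cont : Continuity d → Continuity (dCF d)
  dCF-cont cont F G p 0≤p = mk⇔ loosen tighten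
    where
    loosen : dCF d F G p → ∀ q → p < q → dCF d F G q
    loosen F~G q p<q ε 0<ε with F~G ε 0<ε
    ... | S , T , FS , GT , dS , dT , dST = S , T , FS , GT , dS , dT ,
      Diam≤-mono cont (+-nonNeg 0≤p (<⇒≤ 0<ε)) (+-monoˡ-≤ ε (<⇒≤ p<q)) dST

    tighten : (∀ q → p < q → dCF d F G q) → dCF d F G p
    tighten F~G ε 0<ε with F~G (p + half ε) (p<p+q (half-pos 0<ε)) (half ε) (half-pos 0<ε)
    ... | S , T , FS , GT , dS , dT , dST =
      S , T , FS , GT , Diam≤-half⇒Diam≤ cont 0<ε dS , Diam≤-half⇒Diam≤ cont 0<ε dT ,
      subst (Diam≤ d (_∪_ d S T)) p+half+half≡p+ε dST
      where
      p+half+half≡p+ε : (p + half ε) + half ε ≡ p + ε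
      p+half+half≡p+ε = trans (+-assoc p (half ε) (half ε)) (cong (p +_) (half+half ε))

theorem2p3 : ∀ {a ℓ} {X : Set a} (x₀ : X) (d : Rel X ℓ) → IsPremetric d →
    IsPseudoPremetric (dCF d)
theorem2p3 _ d premetric = record
  { refl0    = dCF-refl0 d
  ; sym      = dCF-sym d
  ; triangle = dCF-triangle d cont triangle
  ; cont     = dCF-cont d cont
  }
  where open IsPremetric premetric using (cont; triangle)
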